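{- Let $M\mapsto M^*$ be the translation from the untyped effect handler calculus to the untyped delimited control calculus that is homomorphic on all core constructs and satisfies $(\mathit{op}\,V)^*=\mathcal{S}_0k.\lambda h.\,h!\,(\mathit{op}\,(V^*,\{\lambda y.\,k!\,y\,h\}))$ (using the operation name $\mathit{op}$ as a variant label) and, for a handler $H=\{\mathtt{return}\,x\mapsto N_{\mathrm{ret}}\}\uplus\{\mathit{op}_i\,p_i\,k_i\mapsto N_i\}_{i=1}^n$, $(\mathtt{handle}\,M\,\mathtt{with}\,H)^*=\langle M^*\mid x.\lambda h.N_{\mathrm{ret}}^*\rangle\,\{H^{\mathrm{ops}}\}$ where $H^{\mathrm{ops}}=\lambda y.\,\mathtt{case}\,y\,\mathtt{of}\,\{\mathit{op}_i\,(p_i,k_i)\mapsto N_i^*\}_{i=1}^n$ (with $h,k,y$ fresh and nested patterns desugared to $\mathtt{let}\,(p_i,k_i)=\cdot\,\mathtt{in}$). Then for all computations $M,N$ of the effect handler calculus, $M\to N$ implies $M^*\rightsquigarrow^{+}N^*$.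
   Context: Core syntax (shared). Values $V ::= x \mid () \mid (V_1,V_2) \mid \ell\,V \mid \{M\}$; computations $M,N ::= \mathtt{let}\,(x,y)=V\,\mathtt{in}\,M \mid \mathtt{case}\,V\,\mathtt{of}\,\{\ell_i x_i\mapsto M_i\}_i \mid V! \mid \mathtt{return}\,V \mid \mathtt{let}\,x\Leftarrow M\,\mathtt{in}\,N \mid \lambda x.M \mid M\,V \mid \langle M_1,M_2\rangle \mid \mathrm{prj}_i M$. Core $\beta$-rules: $\mathtt{let}\,(x,y)=(V_1,V_2)\,\mathtt{in}\,M \to_\beta M[V_1/x,V_2/y]$; $\mathtt{case}\,\ell_j V\,\mathtt{of}\,\{\dots\ell_j x_j\mapsto M_j\dots\}\to_\beta M_j[V/x_j]$; $\{M\}!\to_\beta M$; $\mathtt{let}\,x\Leftarrow\mathtt{return}\,V\,\mathtt{in}\,N\to_\beta N[V/x]$; $(\lambda x.M)V\to_\beta M[V/x]$; $\mathrm{prj}_i\langle M_1,M_2\rangle\to_\beta M_i$. Basic frames $B ::= \mathtt{let}\,x\Leftarrow[\,]\,\mathtt{in}\,N\mid[\,]\,V\mid\mathrm{prj}_i[\,]$; hoisting contexts $\mathcal{H}::=[\,]\mid\mathcal{H}[B]$. In each calculus $M\to N$ iff $M=K[M']$, $N=K[N']$ with $M'\to_\beta N'$ and $K$ an evaluation context of that calculus. Effect handler calculus: operation names $\mathit{op}$; adds computations $\mathit{op}\,V$ and $\mathtt{handle}\,M\,\mathtt{with}\,H$, where $H$ has a return clause $\mathtt{return}\,x\mapsto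 N_{\mathrm{ret}}$ and operation clauses $\mathit{op}\,p\,k\mapsto N_{\mathit{op}}$ for $\mathit{op}$ in a finite set $\mathrm{ops}(H)$; evaluation contexts $K::=[\,]\mid K[B]\mid K[\mathtt{handle}\,[\,]\,\mathtt{with}\,H]$; extra rules $\mathtt{handle}\,(\mathtt{return}\,V)\,\mathtt{with}\,H\to_\beta N_{\mathrm{ret}}[V/x]$ and $\mathtt{handle}\,\mathcal{H}[\mathit{op}\,V]\,\mathtt{with}\,H\to_\beta N_{\mathit{op}}[V/p,\{\lambda y.\mathtt{handle}\,\mathcal{H}[\mathtt{return}\,y]\,\mathtt{with}\,H\}/k]$ for $\mathit{op}\in\mathrm{ops}(H)$. Delimited control calculus: adds computations $\mathcal{S}_0k.M$ and $\langle M\mid x.N\rangle$; evaluation contexts $K::=[\,]\mid K[B]\mid K[\langle[\,]\mid x.N\rangle]$; extra rules $\langle\mathtt{return}\,V\mid x.N\rangle\to_\beta N[V/x]$ and $\langle\mathcal{H}[\mathcal{S}_0k.M]\mid x.N\rangle\to_\beta M[\{\lambda y.\langle\mathcal{H}[\mathtt{return}\,y]\mid x.N\rangle\}/k]$. $\rightsquigarrow$ is the smallest relation on target terms containing $\to_\beta$ and closed under all term-forming constructs; $\rightsquigarrow^{+}$ is its transitive closure. -}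

module Defs where

open import Data.Nat using (ℕ; zero; suc)
open import Data.Fin using (Fin; zero; suc)
open import Data.List using (List; []; _∷_)
open import Data.Product using (_×_; _,_)
open import Data.List.Membership.Propositional using (_∈_)

-- Syntax (well-scoped de Bruijn).  Both calculi share one syntax,
-- indexed by the calculus; the extension constructors are restricted
-- to their calculus by the index.

-- Variant labels and operation names (operation names are used as labels).
Label : Set
Label = ℕ

data Calc : Set where
  eff : Calc
  del : Calc

data PrjIx : Set where
  fst snd : PrjIx

mutual
  data Val : Calc → ℕ → Set where
    var   : ∀ {c n} → Fin n → Val c n
    unit  : ∀ {c n} → Val c n
    pair  : ∀ {c n} → Val c n → Val c n → Val c n
    inj   : ∀ {c n} → Label → Val c n → Val c n
    thunk : ∀ {c n} → Comp c n → Val c n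

  data Comp : Calc → ℕ → Set where
    -- let (x,y) = V in M ; in M, y = var 0 and x = var 1
    split  : ∀ {c n} → Val c n → Comp c (suc (suc n)) → Comp c n
    -- case V of {ℓ_i x_i ↦ M_i}_i ; x_i = var 0
    case   : ∀ {c n} → Val c n → List (Label × Comp c (suc n)) → Comp c n
    force  : ∀ {c n} → Val c n → Comp c n
    ret    : ∀ {c n} → Val c n → Comp c n
    letin  : ∀ {c n} → Comp c n → Comp c (suc n) → Comp c n
    lam    : ∀ {c n} → Comp c (suc n) → Comp c n
    app    : ∀ {c n} → Comp c n → Val c n → Comp c n
    cpair  : ∀ {c n} → Comp c n → Comp c n → Comp c n
    prj    : ∀ {c n} → PrjIx → Comp c n → Comp c n
    opcall : ∀ {n} → Label → Val eff n → Comp eff n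
    handle : ∀ {n} → Comp eff n → Handler n → Comp eff n
    shift0 : ∀ {n} → Comp del (suc n) → Comp del n       -- S₀k.M ; k = var 0
    reset  : ∀ {n} → Comp del n → Comp del (suc n) → Comp del n

  -- handler: return clause (x = var 0) and operation clauses op p k ↦ N
  -- (k = var 0, p = var 1)
  data Handler (n : ℕ) : Set where
    handler : Comp eff (suc n) → List (Label × Comp eff (suc (suc n))) → Handler n

retClause : ∀ {n} → Handler n → Comp eff (suc n)
retClause (handler N _) = N

opClauses : ∀ {n} → Handler n → List (Label × Comp eff (suc (suc n)))
opClauses (handler _ ops) = ops

Ren : ℕ → ℕ → Set
Ren n m = Fin n → Fin m

extR : ∀ {n m} → Ren n m → Ren (suc n) (suc m)
extR ρ zero    = zero
extR ρ (suc i) = suc (ρ i)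

mutual
  renV : ∀ {c n m} → Ren n m → Val c n → Val c m
  renV ρ (var i)    = var (ρ i)
  renV ρ unit       = unit
  renV ρ (pair V W) = pair (renV ρ V) (renV ρ W)
  renV ρ (inj ℓ V)  = inj ℓ (renV ρ V)
  renV ρ (thunk M)  = thunk (renC ρ M)

  renC : ∀ {c n m} → Ren n m → Comp c n → Comp c m
  renC ρ (split V M)   = split (renV ρ V) (renC (extR (extR ρ)) M)
  renC ρ (case V cs)   = case (renV ρ V) (renCls (extR ρ) cs)
  renC ρ (force V)     = force (renV ρ V)
  renC ρ (ret V)       = ret (renV ρ V)
  renC ρ (letin M N)   = letin (renC ρ M) (renC (extR ρ) N)
  renC ρ (lam M)       = lam (renC (extR ρ) M)
  renC ρ (app M V)     = app (renC ρ M) (renV ρ V)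
  renC ρ (cpair M N)   = cpair (renC ρ M) (renC ρ N)
  renC ρ (prj i M)     = prj i (renC ρ M)
  renC ρ (opcall ℓ V)  = opcall ℓ (renV ρ V)
  renC ρ (handle M H)  = handle (renC ρ M) (renH ρ H)
  renC ρ (shift0 M)    = shift0 (renC (extR ρ) M)
  renC ρ (reset M N)   = reset (renC ρ M) (renC (extR ρ) N)

  renCls : ∀ {c n m} → Ren n m → List (Label × Comp c n) → List (Label × Comp c m)
  renCls ρ []             = []
  renCls ρ ((ℓ , M) ∷ cs) = (ℓ , renC ρ M) ∷ renCls ρ cs

  renH : ∀ {n m} → Ren n m → Handler n → Handler m
  renH ρ (handler N ops) = handler (renC (extR ρ) N) (renCls (extR (extR ρ)) ops)

Sub : Calc → ℕ → ℕ → Set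
Sub c n m = Fin n → Val c m

extS : ∀ {c n m} → Sub c n m → Sub c (suc n) (suc m)
extS σ zero    = var zero
extS σ (suc i) = renV suc (σ i)

mutual
  subV : ∀ {c n m} → Sub c n m → Val c n → Val c m
  subV σ (var i)    = σ i
  subV σ unit       = unit
  subV σ (pair V W) = pair (subV σ V) (subV σ W)
  subV σ (inj ℓ V)  = inj ℓ (subV σ V)
  subV σ (thunk M)  = thunk (subC σ M)

  subC : ∀ {c n m} → Sub c n m → Comp c n → Comp c m
  subC σ (split V M)   = split (subV σ V) (subC (extS (extS σ)) M)
  subC σ (case V cs)   = case (subV σ V) (subCls (extS σ) cs)
  subC σ (force V)     = force (subV σ V)
  subC σ (ret V)       = ret (subV σ V)
  subC σ (letin M N)   = letin (subC σ M) (subC (extS σ) N)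
  subC σ (lam M)       = lam (subC (extS σ) M)
  subC σ (app M V)     = app (subC σ M) (subV σ V)
  subC σ (cpair M N)   = cpair (subC σ M) (subC σ N)
  subC σ (prj i M)     = prj i (subC σ M)
  subC σ (opcall ℓ V)  = opcall ℓ (subV σ V)
  subC σ (handle M H)  = handle (subC σ M) (subH σ H)
  subC σ (shift0 M)    = shift0 (subC (extS σ) M)
  subC σ (reset M N)   = reset (subC σ M) (subC (extS σ) N)

  subCls : ∀ {c n m} → Sub c n m → List (Label × Comp c n) → List (Label × Comp c m)
  subCls σ []             = []
  subCls σ ((ℓ , M) ∷ cs) = (ℓ , subC σ M) ∷ subCls σ cs

  subH : ∀ {n m} → Sub eff n m → Handler n → Handler m
  subH σ (handler N ops) = handler (subC (extS σ) N) (subCls (extS (extS σ)) ops)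

sub1 : ∀ {c n} → Val c n → Sub c (suc n) n
sub1 V zero    = V
sub1 V (suc i) = var i

_[_] : ∀ {c n} → Comp c (suc n) → Val c n → Comp c n
M [ V ] = subC (sub1 V) M

sub2 : ∀ {c n} → Val c n → Val c n → Sub c (suc (suc n)) n
sub2 V₁ V₂ zero          = V₂
sub2 V₁ V₂ (suc zero)    = V₁
sub2 V₁ V₂ (suc (suc i)) = var i

data BFrame (c : Calc) (n : ℕ) : Set where
  letF : Comp c (suc n) → BFrame c n
  appF : Val c n → BFrame c n
  prjF : PrjIx → BFrame c n

plugB : ∀ {c n} → BFrame c n → Comp c n → Comp c n
plugB (letF N) M = letin M N
plugB (appF V) M = app M V
plugB (prjF i) M = prj i M

renB : ∀ {c n m} → Ren n m → BFrame c n → BFrame c m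
renB ρ (letF N) = letF (renC (extR ρ) N)
renB ρ (appF V) = appF (renV ρ V)
renB ρ (prjF i) = prjF i

data HCtx (c : Calc) (n : ℕ) : Set where
  hole : HCtx c n
  _▷_  : HCtx c n → BFrame c n → HCtx c n

plugH : ∀ {c n} → HCtx c n → Comp c n → Comp c n
plugH hole    M = M
plugH (K ▷ B) M = plugH K (plugB B M)

renHCtx : ∀ {c n m} → Ren n m → HCtx c n → HCtx c m
renHCtx ρ hole    = hole
renHCtx ρ (K ▷ B) = renHCtx ρ K ▷ renB ρ B

data Frame : Calc → ℕ → Set where
  basic   : ∀ {c n} → BFrame c n → Frame c n
  handleF : ∀ {n} → Handler n → Frame eff n
  resetF  : ∀ {n} → Comp del (suc n) → Frame del n

plugF : ∀ {c n} → Frame c n → Comp c n → Comp c n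
plugF (basic B)   M = plugB B M
plugF (handleF H) M = handle M H
plugF (resetF N)  M = reset M N

data ECtx (c : Calc) (n : ℕ) : Set where
  hole : ECtx c n
  _▷_  : ECtx c n → Frame c n → ECtx c n

plugE : ∀ {c n} → ECtx c n → Comp c n → Comp c n
plugE hole    M = M
plugE (K ▷ F) M = plugE K (plugF F M)

data CoreBeta {c : Calc} {n : ℕ} : Comp c n → Comp c n → Set where
  β-split : ∀ {V₁ V₂ M} → CoreBeta (split (pair V₁ V₂) M) (subC (sub2 V₁ V₂) M)
  β-case  : ∀ {ℓ V M cs} → (ℓ , M) ∈ cs → CoreBeta (case (inj ℓ V) cs) (M [ V ])
  β-force : ∀ {M} → CoreBeta (force (thunk M)) M
  β-let   : ∀ {V N} → CoreBeta (letin (ret V) N) (N [ V ])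
  β-app   : ∀ {M V} → CoreBeta (app (lam M) V) (M [ V ])
  β-prj₁  : ∀ {M₁ M₂} → CoreBeta (prj fst (cpair M₁ M₂)) M₁
  β-prj₂  : ∀ {M₁ M₂} → CoreBeta (prj snd (cpair M₁ M₂)) M₂

data EffBeta {n : ℕ} : Comp eff n → Comp eff n → Set where
  core  : ∀ {M N} → CoreBeta M N → EffBeta M N
  β-ret : ∀ {V H} → EffBeta (handle (ret V) H) (retClause H [ V ])
  β-op  : ∀ {K ℓ V H N} → (ℓ , N) ∈ opClauses H →
          EffBeta (handle (plugH K (opcall ℓ V)) H)
                  (subC (sub2 V (thunk (lam (handle (plugH (renHCtx suc K) (ret (var zero)))
                                                    (renH suc H))))) N)

data DelBeta {n : ℕ} : Comp del n → Comp del n → Set where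
  core    : ∀ {M N} → CoreBeta M N → DelBeta M N
  β-reset : ∀ {V N} → DelBeta (reset (ret V) N) (N [ V ])
  β-shift : ∀ {K M N} →
            DelBeta (reset (plugH K (shift0 M)) N)
                    (M [ thunk (lam (reset (plugH (renHCtx suc K) (ret (var zero)))
                                           (renC (extR suc) N))) ])

data _⟶ₑ_ {n : ℕ} : Comp eff n → Comp eff n → Set where
  step : ∀ (K : ECtx eff n) {M N} → EffBeta M N → plugE K M ⟶ₑ plugE K N

mutual
  data _⇝_ {n : ℕ} : Comp del n → Comp del n → Set where
    beta     : ∀ {M N} → DelBeta M N → M ⇝ N
    split₁   : ∀ {V V' M} → V ⇝ᵛ V' → split V M ⇝ split V' M
    split₂   : ∀ {V M M'} → M ⇝ M' → split V M ⇝ split V M'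
    case₁    : ∀ {V V' cs} → V ⇝ᵛ V' → case V cs ⇝ case V' cs
    case₂    : ∀ {V cs cs'} → cs ⇝ᶜ cs' → case V cs ⇝ case V cs'
    force₁   : ∀ {V V'} → V ⇝ᵛ V' → force V ⇝ force V'
    ret₁     : ∀ {V V'} → V ⇝ᵛ V' → ret V ⇝ ret V'
    letin₁   : ∀ {M M' N} → M ⇝ M' → letin M N ⇝ letin M' N
    letin₂   : ∀ {M N N'} → N ⇝ N' → letin M N ⇝ letin M N'
    lam₁     : ∀ {M M'} → M ⇝ M' → lam M ⇝ lam M'
    app₁     : ∀ {M M' V} → M ⇝ M' → app M V ⇝ app M' V
    app₂     : ∀ {M V V'} → V ⇝ᵛ V' → app M V ⇝ app M V'
    cpair₁   : ∀ {M M' N} → M ⇝ M' → cpair M N ⇝ cpair M' N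
    cpair₂   : ∀ {M N N'} → N ⇝ N' → cpair M N ⇝ cpair M N'
    prj₁     : ∀ {i M M'} → M ⇝ M' → prj i M ⇝ prj i M'
    shift0₁  : ∀ {M M'} → M ⇝ M' → shift0 M ⇝ shift0 M'
    reset₁   : ∀ {M M' N} → M ⇝ M' → reset M N ⇝ reset M' N
    reset₂   : ∀ {M N N'} → N ⇝ N' → reset M N ⇝ reset M N'

  data _⇝ᵛ_ {n : ℕ} : Val del n → Val del n → Set where
    pair₁  : ∀ {V V' W} → V ⇝ᵛ V' → pair V W ⇝ᵛ pair V' W
    pair₂  : ∀ {V W W'} → W ⇝ᵛ W' → pair V W ⇝ᵛ pair V W'
    inj₁   : ∀ {ℓ V V'} → V ⇝ᵛ V' → inj ℓ V ⇝ᵛ inj ℓ V'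
    thunk₁ : ∀ {M M'} → M ⇝ M' → thunk M ⇝ᵛ thunk M'

  data _⇝ᶜ_ {n : ℕ} : List (Label × Comp del n) → List (Label × Comp del n) → Set where
    here  : ∀ {ℓ M M' cs} → M ⇝ M' → ((ℓ , M) ∷ cs) ⇝ᶜ ((ℓ , M') ∷ cs)
    there : ∀ {c cs cs'} → cs ⇝ᶜ cs' → (c ∷ cs) ⇝ᶜ (c ∷ cs')

wk2 : ∀ {n} → Ren n (suc (suc n))
wk2 i = suc (suc i)

mutual
  trV : ∀ {n} → Val eff n → Val del n
  trV (var i)    = var i
  trV unit       = unit
  trV (pair V W) = pair (trV V) (trV W)
  trV (inj ℓ V)  = inj ℓ (trV V)
  trV (thunk M)  = thunk (trC M)

  trC : ∀ {n} → Comp eff n → Comp del n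
  trC (split V M)  = split (trV V) (trC M)
  trC (case V cs)  = case (trV V) (trCls cs)
  trC (force V)    = force (trV V)
  trC (ret V)      = ret (trV V)
  trC (letin M N)  = letin (trC M) (trC N)
  trC (lam M)      = lam (trC M)
  trC (app M V)    = app (trC M) (trV V)
  trC (cpair M N)  = cpair (trC M) (trC N)
  trC (prj i M)    = prj i (trC M)
  -- (op V)* = S₀k. λh. h! (op (V*, {λy. k! y h}))
  --   under S₀k, λh : h = var 0, k = var 1 ; under λy additionally y = var 0
  trC (opcall ℓ V) =
    shift0 (lam (app (force (var zero))
                     (inj ℓ (pair (renV wk2 (trV V))
                                  (thunk (lam (app (app (force (var (suc (suc zero)))) (var zero))
                                                   (var (suc zero)))))))))
  trC (handle M (handler N ops)) =
    app (reset (trC M) (lam (renC suc (trC N))))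
        (thunk (lam (case (var zero) (trOps ops))))

  trCls : ∀ {n} → List (Label × Comp eff n) → List (Label × Comp del n)
  trCls []             = []
  trCls ((ℓ , M) ∷ cs) = (ℓ , trC M) ∷ trCls cs

  -- clauses of H^ops = λy. case y of {op_i z ↦ let (p_i,k_i) = z in N_i*}
  -- (N_i has k_i = var 0, p_i = var 1; the fresh y, z are inserted above them)
  trOps : ∀ {n} → List (Label × Comp eff (suc (suc n))) → List (Label × Comp del (suc (suc n)))
  trOps []             = []
  trOps ((ℓ , N) ∷ os) = (ℓ , split (var zero) (renC (extR (extR wk2)) (trC N))) ∷ trOps os

-- The translation is compositional, so it commutes with renaming, substitution and hoisting
-- contexts, and an evaluation context of the handler calculus becomes a compatible context of
-- the target; it therefore suffices to simulate the β-rules at the root. Core β-steps are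
-- simulated by the same step. Returning from a handler takes a reset step and the application
-- of λh.N_ret* to {H^ops}. An operation call takes eight steps: the S₀ of (op V)* reaches the
-- reset introduced by the translated handle and captures exactly the translated hoisting
-- context, so that, once k! y h is reduced inside the resumption, the resumption passed to the
-- clause is the translation of the source resumption.

module Submission where

open import Defs
open import Data.Nat using (ℕ; zero; suc)
open import Data.Fin using (zero; suc)
open import Data.List using (List; []; _∷_)
open import Data.List.Membership.Propositional using (_∈_)
open import Data.List.Relation.Unary.Any using (here; there)
open import Data.Product using (_×_; _,_)
open import Function using (_∘_)
open import Relation.Binary.PropositionalEquality hiding ([_])
open import Relation.Binary.Construct.Closure.Transitive using (TransClosure; [_]; _∷_)

variable
  c : Calc
  n m m′ k k′ : ℕ

cong-clause : {A : Set} {ℓ : Label} {M M′ : A} {cs cs′ : List (Label × A)} →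
              M ≡ M′ → cs ≡ cs′ → (ℓ , M) ∷ cs ≡ (ℓ , M′) ∷ cs′
cong-clause = cong₂ (λ M cs → (_ , M) ∷ cs)

extR-extR : {ρ : Ren m k} {τ : Ren n m} {θ : Ren n k} →
            ρ ∘ τ ≗ θ → extR ρ ∘ extR τ ≗ extR θ
extR-extR eq zero    = refl
extR-extR eq (suc i) = cong suc (eq i)

mutual
  renV-renV : {ρ : Ren m k} {τ : Ren n m} {θ : Ren n k} →
              ρ ∘ τ ≗ θ → (V : Val c n) → renV ρ (renV τ V) ≡ renV θ V
  renV-renV eq (var i)    = cong var (eq i)
  renV-renV eq unit       = refl
  renV-renV eq (pair V W) = cong₂ pair (renV-renV eq V) (renV-renV eq W)
  renV-renV eq (inj ℓ V)  = cong (inj ℓ) (renV-renV eq V)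
  renV-renV eq (thunk M)  = cong thunk (renC-renC eq M)

  renC-renC : {ρ : Ren m k} {τ : Ren n m} {θ : Ren n k} →
              ρ ∘ τ ≗ θ → (M : Comp c n) → renC ρ (renC τ M) ≡ renC θ M
  renC-renC eq (split V M)  = cong₂ split (renV-renV eq V) (renC-renC (extR-extR (extR-extR eq)) M)
  renC-renC eq (case V cs)  = cong₂ case (renV-renV eq V) (renCls-renCls (extR-extR eq) cs)
  renC-renC eq (force V)    = cong force (renV-renV eq V)
  renC-renC eq (ret V)      = cong ret (renV-renV eq V)
  renC-renC eq (letin M N)  = cong₂ letin (renC-renC eq M) (renC-renC (extR-extR eq) N)
  renC-renC eq (lam M)      = cong lam (renC-renC (extR-extR eq) M)
  renC-renC eq (app M V)    = cong₂ app (renC-renC eq M) (renV-renV eq V)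
  renC-renC eq (cpair M N)  = cong₂ cpair (renC-renC eq M) (renC-renC eq N)
  renC-renC eq (prj i M)    = cong (prj i) (renC-renC eq M)
  renC-renC eq (opcall ℓ V) = cong (opcall ℓ) (renV-renV eq V)
  renC-renC eq (handle M H) = cong₂ handle (renC-renC eq M) (renH-renH eq H)
  renC-renC eq (shift0 M)   = cong shift0 (renC-renC (extR-extR eq) M)
  renC-renC eq (reset M N)  = cong₂ reset (renC-renC eq M) (renC-renC (extR-extR eq) N)

  renCls-renCls : {ρ : Ren m k} {τ : Ren n m} {θ : Ren n k} →
                  ρ ∘ τ ≗ θ → (cs : List (Label × Comp c n)) →
                  renCls ρ (renCls τ cs) ≡ renCls θ cs
  renCls-renCls eq []             = refl
  renCls-renCls eq ((ℓ , M) ∷ cs) = cong-clause (renC-renC eq M) (renCls-renCls eq cs)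

  renH-renH : {ρ : Ren m k} {τ : Ren n m} {θ : Ren n k} →
              ρ ∘ τ ≗ θ → (H : Handler n) → renH ρ (renH τ H) ≡ renH θ H
  renH-renH eq (handler N ops) =
    cong₂ handler (renC-renC (extR-extR eq) N) (renCls-renCls (extR-extR (extR-extR eq)) ops)

extS-extR : {σ : Sub c m k} {ρ : Ren n m} {θ : Sub c n k} →
            σ ∘ ρ ≗ θ → extS σ ∘ extR ρ ≗ extS θ
extS-extR eq zero    = refl
extS-extR eq (suc i) = cong (renV suc) (eq i)

mutual
  subV-renV : {σ : Sub c m k} {ρ : Ren n m} {θ : Sub c n k} →
              σ ∘ ρ ≗ θ → (V : Val c n) → subV σ (renV ρ V) ≡ subV θ V
  subV-renV eq (var i)    = eq i
  subV-renV eq unit       = refl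
  subV-renV eq (pair V W) = cong₂ pair (subV-renV eq V) (subV-renV eq W)
  subV-renV eq (inj ℓ V)  = cong (inj ℓ) (subV-renV eq V)
  subV-renV eq (thunk M)  = cong thunk (subC-renC eq M)

  subC-renC : {σ : Sub c m k} {ρ : Ren n m} {θ : Sub c n k} →
              σ ∘ ρ ≗ θ → (M : Comp c n) → subC σ (renC ρ M) ≡ subC θ M
  subC-renC eq (split V M)  = cong₂ split (subV-renV eq V) (subC-renC (extS-extR (extS-extR eq)) M)
  subC-renC eq (case V cs)  = cong₂ case (subV-renV eq V) (subCls-renCls (extS-extR eq) cs)
  subC-renC eq (force V)    = cong force (subV-renV eq V)
  subC-renC eq (ret V)      = cong ret (subV-renV eq V)
  subC-renC eq (letin M N)  = cong₂ letin (subC-renC eq M) (subC-renC (extS-extR eq) N)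
  subC-renC eq (lam M)      = cong lam (subC-renC (extS-extR eq) M)
  subC-renC eq (app M V)    = cong₂ app (subC-renC eq M) (subV-renV eq V)
  subC-renC eq (cpair M N)  = cong₂ cpair (subC-renC eq M) (subC-renC eq N)
  subC-renC eq (prj i M)    = cong (prj i) (subC-renC eq M)
  subC-renC eq (opcall ℓ V) = cong (opcall ℓ) (subV-renV eq V)
  subC-renC eq (handle M H) = cong₂ handle (subC-renC eq M) (subH-renH eq H)
  subC-renC eq (shift0 M)   = cong shift0 (subC-renC (extS-extR eq) M)
  subC-renC eq (reset M N)  = cong₂ reset (subC-renC eq M) (subC-renC (extS-extR eq) N)

  subCls-renCls : {σ : Sub c m k} {ρ : Ren n m} {θ : Sub c n k} →
                  σ ∘ ρ ≗ θ → (cs : List (Label × Comp c n)) →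
                  subCls σ (renCls ρ cs) ≡ subCls θ cs
  subCls-renCls eq []             = refl
  subCls-renCls eq ((ℓ , M) ∷ cs) = cong-clause (subC-renC eq M) (subCls-renCls eq cs)

  subH-renH : {σ : Sub eff m k} {ρ : Ren n m} {θ : Sub eff n k} →
              σ ∘ ρ ≗ θ → (H : Handler n) → subH σ (renH ρ H) ≡ subH θ H
  subH-renH eq (handler N ops) =
    cong₂ handler (subC-renC (extS-extR eq) N) (subCls-renCls (extS-extR (extS-extR eq)) ops)

renV-comm : {ρ : Ren m k} {τ : Ren n m} {ρ′ : Ren m′ k} {τ′ : Ren n m′} →
            ρ ∘ τ ≗ ρ′ ∘ τ′ → (V : Val c n) → renV ρ (renV τ V) ≡ renV ρ′ (renV τ′ V)
renV-comm eq V = trans (renV-renV eq V) (sym (renV-renV (λ _ → refl) V))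

renC-comm : {ρ : Ren m k} {τ : Ren n m} {ρ′ : Ren m′ k} {τ′ : Ren n m′} →
            ρ ∘ τ ≗ ρ′ ∘ τ′ → (M : Comp c n) → renC ρ (renC τ M) ≡ renC ρ′ (renC τ′ M)
renC-comm eq M = trans (renC-renC eq M) (sym (renC-renC (λ _ → refl) M))

extR-extS : {ρ : Ren m k} {σ : Sub c n m} {θ : Sub c n k} →
            renV ρ ∘ σ ≗ θ → renV (extR ρ) ∘ extS σ ≗ extS θ
extR-extS eq zero    = refl
extR-extS {σ = σ} eq (suc i) = trans (renV-comm (λ _ → refl) (σ i)) (cong (renV suc) (eq i))

mutual
  renV-subV : {ρ : Ren m k} {σ : Sub c n m} {θ : Sub c n k} →
              renV ρ ∘ σ ≗ θ → (V : Val c n) → renV ρ (subV σ V) ≡ subV θ V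
  renV-subV eq (var i)    = eq i
  renV-subV eq unit       = refl
  renV-subV eq (pair V W) = cong₂ pair (renV-subV eq V) (renV-subV eq W)
  renV-subV eq (inj ℓ V)  = cong (inj ℓ) (renV-subV eq V)
  renV-subV eq (thunk M)  = cong thunk (renC-subC eq M)

  renC-subC : {ρ : Ren m k} {σ : Sub c n m} {θ : Sub c n k} →
              renV ρ ∘ σ ≗ θ → (M : Comp c n) → renC ρ (subC σ M) ≡ subC θ M
  renC-subC eq (split V M)  = cong₂ split (renV-subV eq V) (renC-subC (extR-extS (extR-extS eq)) M)
  renC-subC eq (case V cs)  = cong₂ case (renV-subV eq V) (renCls-subCls (extR-extS eq) cs)
  renC-subC eq (force V)    = cong force (renV-subV eq V)
  renC-subC eq (ret V)      = cong ret (renV-subV eq V)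
  renC-subC eq (letin M N)  = cong₂ letin (renC-subC eq M) (renC-subC (extR-extS eq) N)
  renC-subC eq (lam M)      = cong lam (renC-subC (extR-extS eq) M)
  renC-subC eq (app M V)    = cong₂ app (renC-subC eq M) (renV-subV eq V)
  renC-subC eq (cpair M N)  = cong₂ cpair (renC-subC eq M) (renC-subC eq N)
  renC-subC eq (prj i M)    = cong (prj i) (renC-subC eq M)
  renC-subC eq (opcall ℓ V) = cong (opcall ℓ) (renV-subV eq V)
  renC-subC eq (handle M H) = cong₂ handle (renC-subC eq M) (renH-subH eq H)
  renC-subC eq (shift0 M)   = cong shift0 (renC-subC (extR-extS eq) M)
  renC-subC eq (reset M N)  = cong₂ reset (renC-subC eq M) (renC-subC (extR-extS eq) N)

  renCls-subCls : {ρ : Ren m k} {σ : Sub c n m} {θ : Sub c n k} →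
                  renV ρ ∘ σ ≗ θ → (cs : List (Label × Comp c n)) →
                  renCls ρ (subCls σ cs) ≡ subCls θ cs
  renCls-subCls eq []             = refl
  renCls-subCls eq ((ℓ , M) ∷ cs) = cong-clause (renC-subC eq M) (renCls-subCls eq cs)

  renH-subH : {ρ : Ren m k} {σ : Sub eff n m} {θ : Sub eff n k} →
              renV ρ ∘ σ ≗ θ → (H : Handler n) → renH ρ (subH σ H) ≡ subH θ H
  renH-subH eq (handler N ops) =
    cong₂ handler (renC-subC (extR-extS eq) N) (renCls-subCls (extR-extS (extR-extS eq)) ops)

extS-extS : {σ : Sub c m k} {τ : Sub c n m} {θ : Sub c n k} →
            subV σ ∘ τ ≗ θ → subV (extS σ) ∘ extS τ ≗ extS θ
extS-extS eq zero = refl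
extS-extS {σ = σ} {τ = τ} {θ = θ} eq (suc i) = begin
  subV (extS σ) (renV suc (τ i)) ≡⟨ subV-renV (λ _ → refl) (τ i) ⟩
  subV (renV suc ∘ σ) (τ i)      ≡⟨ renV-subV (λ _ → refl) (τ i) ⟨
  renV suc (subV σ (τ i))        ≡⟨ cong (renV suc) (eq i) ⟩
  renV suc (θ i)                ∎
  where open ≡-Reasoning

mutual
  subV-subV : {σ : Sub c m k} {τ : Sub c n m} {θ : Sub c n k} →
              subV σ ∘ τ ≗ θ → (V : Val c n) → subV σ (subV τ V) ≡ subV θ V
  subV-subV eq (var i)    = eq i
  subV-subV eq unit       = refl
  subV-subV eq (pair V W) = cong₂ pair (subV-subV eq V) (subV-subV eq W)
  subV-subV eq (inj ℓ V)  = cong (inj ℓ) (subV-subV eq V)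
  subV-subV eq (thunk M)  = cong thunk (subC-subC eq M)

  subC-subC : {σ : Sub c m k} {τ : Sub c n m} {θ : Sub c n k} →
              subV σ ∘ τ ≗ θ → (M : Comp c n) → subC σ (subC τ M) ≡ subC θ M
  subC-subC eq (split V M)  = cong₂ split (subV-subV eq V) (subC-subC (extS-extS (extS-extS eq)) M)
  subC-subC eq (case V cs)  = cong₂ case (subV-subV eq V) (subCls-subCls (extS-extS eq) cs)
  subC-subC eq (force V)    = cong force (subV-subV eq V)
  subC-subC eq (ret V)      = cong ret (subV-subV eq V)
  subC-subC eq (letin M N)  = cong₂ letin (subC-subC eq M) (subC-subC (extS-extS eq) N)
  subC-subC eq (lam M)      = cong lam (subC-subC (extS-extS eq) M)
  subC-subC eq (app M V)    = cong₂ app (subC-subC eq M) (subV-subV eq V)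
  subC-subC eq (cpair M N)  = cong₂ cpair (subC-subC eq M) (subC-subC eq N)
  subC-subC eq (prj i M)    = cong (prj i) (subC-subC eq M)
  subC-subC eq (opcall ℓ V) = cong (opcall ℓ) (subV-subV eq V)
  subC-subC eq (handle M H) = cong₂ handle (subC-subC eq M) (subH-subH eq H)
  subC-subC eq (shift0 M)   = cong shift0 (subC-subC (extS-extS eq) M)
  subC-subC eq (reset M N)  = cong₂ reset (subC-subC eq M) (subC-subC (extS-extS eq) N)

  subCls-subCls : {σ : Sub c m k} {τ : Sub c n m} {θ : Sub c n k} →
                  subV σ ∘ τ ≗ θ → (cs : List (Label × Comp c n)) →
                  subCls σ (subCls τ cs) ≡ subCls θ cs
  subCls-subCls eq []             = refl
  subCls-subCls eq ((ℓ , M) ∷ cs) = cong-clause (subC-subC eq M) (subCls-subCls eq cs)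

  subH-subH : {σ : Sub eff m k} {τ : Sub eff n m} {θ : Sub eff n k} →
              subV σ ∘ τ ≗ θ → (H : Handler n) → subH σ (subH τ H) ≡ subH θ H
  subH-subH eq (handler N ops) =
    cong₂ handler (subC-subC (extS-extS eq) N) (subCls-subCls (extS-extS (extS-extS eq)) ops)

extS-id : {σ : Sub c n n} → σ ≗ var → extS σ ≗ var
extS-id eq zero    = refl
extS-id eq (suc i) = cong (renV suc) (eq i)

mutual
  subV-id : {σ : Sub c n n} → σ ≗ var → (V : Val c n) → subV σ V ≡ V
  subV-id eq (var i)    = eq i
  subV-id eq unit       = refl
  subV-id eq (pair V W) = cong₂ pair (subV-id eq V) (subV-id eq W)
  subV-id eq (inj ℓ V)  = cong (inj ℓ) (subV-id eq V)
  subV-id eq (thunk M)  = cong thunk (subC-id eq M)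

  subC-id : {σ : Sub c n n} → σ ≗ var → (M : Comp c n) → subC σ M ≡ M
  subC-id eq (split V M)  = cong₂ split (subV-id eq V) (subC-id (extS-id (extS-id eq)) M)
  subC-id eq (case V cs)  = cong₂ case (subV-id eq V) (subCls-id (extS-id eq) cs)
  subC-id eq (force V)    = cong force (subV-id eq V)
  subC-id eq (ret V)      = cong ret (subV-id eq V)
  subC-id eq (letin M N)  = cong₂ letin (subC-id eq M) (subC-id (extS-id eq) N)
  subC-id eq (lam M)      = cong lam (subC-id (extS-id eq) M)
  subC-id eq (app M V)    = cong₂ app (subC-id eq M) (subV-id eq V)
  subC-id eq (cpair M N)  = cong₂ cpair (subC-id eq M) (subC-id eq N)
  subC-id eq (prj i M)    = cong (prj i) (subC-id eq M)
  subC-id eq (opcall ℓ V) = cong (opcall ℓ) (subV-id eq V)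
  subC-id eq (handle M H) = cong₂ handle (subC-id eq M) (subH-id eq H)
  subC-id eq (shift0 M)   = cong shift0 (subC-id (extS-id eq) M)
  subC-id eq (reset M N)  = cong₂ reset (subC-id eq M) (subC-id (extS-id eq) N)

  subCls-id : {σ : Sub c n n} → σ ≗ var → (cs : List (Label × Comp c n)) → subCls σ cs ≡ cs
  subCls-id eq []             = refl
  subCls-id eq ((ℓ , M) ∷ cs) = cong-clause (subC-id eq M) (subCls-id eq cs)

  subH-id : {σ : Sub eff n n} → σ ≗ var → (H : Handler n) → subH σ H ≡ H
  subH-id eq (handler N ops) = cong₂ handler (subC-id (extS-id eq) N) (subCls-id (extS-id (extS-id eq)) ops)

renV-subV-comm : {ρ : Ren m k} {σ : Sub c n m} {σ′ : Sub c m′ k} {ρ′ : Ren n m′} →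
                 renV ρ ∘ σ ≗ σ′ ∘ ρ′ → (V : Val c n) →
                 renV ρ (subV σ V) ≡ subV σ′ (renV ρ′ V)
renV-subV-comm eq V = trans (renV-subV eq V) (sym (subV-renV (λ _ → refl) V))

renC-subC-comm : {ρ : Ren m k} {σ : Sub c n m} {σ′ : Sub c m′ k} {ρ′ : Ren n m′} →
                 renV ρ ∘ σ ≗ σ′ ∘ ρ′ → (M : Comp c n) →
                 renC ρ (subC σ M) ≡ subC σ′ (renC ρ′ M)
renC-subC-comm eq M = trans (renC-subC eq M) (sym (subC-renC (λ _ → refl) M))

weaken⁴-under₂ : (V : Val c n) →
                 renV (extR (extR wk2)) (renV suc (renV suc V)) ≡ renV suc (renV suc (renV suc (renV suc V)))
weaken⁴-under₂ V = begin
  renV (extR (extR wk2)) (renV suc (renV suc V))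
    ≡⟨ cong (renV (extR (extR wk2))) (renV-renV (λ _ → refl) V) ⟩
  renV (extR (extR wk2)) (renV wk2 V)
    ≡⟨ renV-renV (λ _ → refl) V ⟩
  renV (λ i → suc (suc (suc (suc i)))) V
    ≡⟨ renV-renV (λ _ → refl) V ⟨
  renV suc (renV (λ i → suc (suc (suc i))) V)
    ≡⟨ cong (renV suc) (renV-renV (λ _ → refl) V) ⟨
  renV suc (renV suc (renV wk2 V))
    ≡⟨ cong (renV suc ∘ renV suc) (renV-renV (λ _ → refl) V) ⟨
  renV suc (renV suc (renV suc (renV suc V)))
    ∎
  where open ≡-Reasoning

subV-sub1-weaken : (W V : Val c n) → subV (sub1 W) (renV suc V) ≡ V
subV-sub1-weaken W V = trans (subV-renV (λ _ → refl) V) (subV-id (λ _ → refl) V)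

subV-subV-renV-id : {σ : Sub c m k} {τ : Sub c n m} {ρ : Ren k n} →
                    (∀ i → subV σ (τ (ρ i)) ≡ var i) → (V : Val c k) →
                    subV σ (subV τ (renV ρ V)) ≡ V
subV-subV-renV-id {σ = σ} eq V =
  trans (cong (subV σ) (subV-renV (λ _ → refl) V)) (trans (subV-subV eq V) (subV-id (λ _ → refl) V))

subC-subC-renC : {σ : Sub c m k} {τ : Sub c n m} {ρ : Ren k′ n} {θ : Sub c k′ k} →
                 (∀ i → subV σ (τ (ρ i)) ≡ θ i) → (M : Comp c k′) →
                 subC σ (subC τ (renC ρ M)) ≡ subC θ M
subC-subC-renC {σ = σ} eq M = trans (cong (subC σ) (subC-renC (λ _ → refl) M)) (subC-subC eq M)

subC-subC-renC-id : {σ : Sub c m k} {τ : Sub c n m} {ρ : Ren k n} →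
                    (∀ i → subV σ (τ (ρ i)) ≡ var i) → (M : Comp c k) →
                    subC σ (subC τ (renC ρ M)) ≡ M
subC-subC-renC-id eq M = trans (subC-subC-renC eq M) (subC-id (λ _ → refl) M)

∈-subCls : {ℓ : Label} {σ : Sub c n m} {M : Comp c n} {cs : List (Label × Comp c n)} →
           (ℓ , M) ∈ cs → (ℓ , subC σ M) ∈ subCls σ cs
∈-subCls {cs = _ ∷ _} (here refl) = here refl
∈-subCls {cs = _ ∷ _} (there p)   = there (∈-subCls p)

retᵗ : Handler n → Comp del (suc n)
retᵗ (handler N _) = lam (renC suc (trC N))

opsᵗ : Handler n → Val del n
opsᵗ (handler _ ops) = thunk (lam (case (var zero) (trOps ops)))

opClauseᵗ : Comp eff (suc (suc n)) → Comp del (suc (suc n))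
opClauseᵗ N = split (var zero) (renC (extR (extR wk2)) (trC N))

trC-handle : (M : Comp eff n) (H : Handler n) → trC (handle M H) ≡ app (reset (trC M) (retᵗ H)) (opsᵗ H)
trC-handle M (handler _ _) = refl

mutual
  trV-renV : (ρ : Ren n m) (V : Val eff n) → trV (renV ρ V) ≡ renV ρ (trV V)
  trV-renV ρ (var i)    = refl
  trV-renV ρ unit       = refl
  trV-renV ρ (pair V W) = cong₂ pair (trV-renV ρ V) (trV-renV ρ W)
  trV-renV ρ (inj ℓ V)  = cong (inj ℓ) (trV-renV ρ V)
  trV-renV ρ (thunk M)  = cong thunk (trC-renC ρ M)

  trC-renC : (ρ : Ren n m) (M : Comp eff n) → trC (renC ρ M) ≡ renC ρ (trC M)
  trC-renC ρ (split V M)  = cong₂ split (trV-renV ρ V) (trC-renC _ M)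
  trC-renC ρ (case V cs)  = cong₂ case (trV-renV ρ V) (trCls-renCls _ cs)
  trC-renC ρ (force V)    = cong force (trV-renV ρ V)
  trC-renC ρ (ret V)      = cong ret (trV-renV ρ V)
  trC-renC ρ (letin M N)  = cong₂ letin (trC-renC ρ M) (trC-renC _ N)
  trC-renC ρ (lam M)      = cong lam (trC-renC _ M)
  trC-renC ρ (app M V)    = cong₂ app (trC-renC ρ M) (trV-renV ρ V)
  trC-renC ρ (cpair M N)  = cong₂ cpair (trC-renC ρ M) (trC-renC ρ N)
  trC-renC ρ (prj i M)    = cong (prj i) (trC-renC ρ M)
  trC-renC ρ (opcall ℓ V) =
    cong (λ V′ → shift0 (lam (app (force (var zero)) (inj ℓ (pair V′ _)))))
         (trans (cong (renV wk2) (trV-renV ρ V)) (renV-comm (λ _ → refl) (trV V)))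
  trC-renC ρ (handle M H@(handler _ _)) =
    cong₂ app (cong₂ reset (trC-renC ρ M) (retᵗ-renH ρ H)) (opsᵗ-renH ρ H)

  trCls-renCls : (ρ : Ren n m) (cs : List (Label × Comp eff n)) → trCls (renCls ρ cs) ≡ renCls ρ (trCls cs)
  trCls-renCls ρ []             = refl
  trCls-renCls ρ ((ℓ , M) ∷ cs) = cong-clause (trC-renC ρ M) (trCls-renCls ρ cs)

  retᵗ-renH : (ρ : Ren n m) (H : Handler n) → retᵗ (renH ρ H) ≡ renC (extR ρ) (retᵗ H)
  retᵗ-renH ρ (handler N _) =
    cong lam (trans (cong (renC suc) (trC-renC (extR ρ) N)) (renC-comm (λ _ → refl) (trC N)))

  opsᵗ-renH : (ρ : Ren n m) (H : Handler n) → opsᵗ (renH ρ H) ≡ renV ρ (opsᵗ H)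
  opsᵗ-renH ρ (handler _ ops) = cong (λ cs → thunk (lam (case (var zero) cs))) (trOps-renCls ρ ops)

  trOps-renCls : (ρ : Ren n m) (os : List (Label × Comp eff (suc (suc n)))) →
                 trOps (renCls (extR (extR ρ)) os) ≡ renCls (extR (extR ρ)) (trOps os)
  trOps-renCls ρ []             = refl
  trOps-renCls ρ ((ℓ , N) ∷ os) = cong-clause (opClauseᵗ-renC ρ N) (trOps-renCls ρ os)

  opClauseᵗ-renC : (ρ : Ren n m) (N : Comp eff (suc (suc n))) →
                   opClauseᵗ (renC (extR (extR ρ)) N) ≡ renC (extR (extR ρ)) (opClauseᵗ N)
  opClauseᵗ-renC ρ N =
    cong (split (var zero))
         (trans (cong (renC (extR (extR wk2))) (trC-renC (extR (extR ρ)) N))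
                (renC-comm (λ { zero → refl ; (suc zero) → refl ; (suc (suc _)) → refl }) (trC N)))

trV-extS : {σ : Sub eff n m} {σ′ : Sub del n m} → trV ∘ σ ≗ σ′ → trV ∘ extS σ ≗ extS σ′
trV-extS eq zero = refl
trV-extS {σ = σ} eq (suc i) = trans (trV-renV suc (σ i)) (cong (renV suc) (eq i))

mutual
  trV-subV : {σ : Sub eff n m} {σ′ : Sub del n m} → trV ∘ σ ≗ σ′ →
             (V : Val eff n) → trV (subV σ V) ≡ subV σ′ (trV V)
  trV-subV eq (var i)    = eq i
  trV-subV eq unit       = refl
  trV-subV eq (pair V W) = cong₂ pair (trV-subV eq V) (trV-subV eq W)
  trV-subV eq (inj ℓ V)  = cong (inj ℓ) (trV-subV eq V)
  trV-subV eq (thunk M)  = cong thunk (trC-subC eq M)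

  trC-subC : {σ : Sub eff n m} {σ′ : Sub del n m} → trV ∘ σ ≗ σ′ →
             (M : Comp eff n) → trC (subC σ M) ≡ subC σ′ (trC M)
  trC-subC eq (split V M)  = cong₂ split (trV-subV eq V) (trC-subC (trV-extS (trV-extS eq)) M)
  trC-subC eq (case V cs)  = cong₂ case (trV-subV eq V) (trCls-subCls (trV-extS eq) cs)
  trC-subC eq (force V)    = cong force (trV-subV eq V)
  trC-subC eq (ret V)      = cong ret (trV-subV eq V)
  trC-subC eq (letin M N)  = cong₂ letin (trC-subC eq M) (trC-subC (trV-extS eq) N)
  trC-subC eq (lam M)      = cong lam (trC-subC (trV-extS eq) M)
  trC-subC eq (app M V)    = cong₂ app (trC-subC eq M) (trV-subV eq V)
  trC-subC eq (cpair M N)  = cong₂ cpair (trC-subC eq M) (trC-subC eq N)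
  trC-subC eq (prj i M)    = cong (prj i) (trC-subC eq M)
  trC-subC {σ′ = σ′} eq (opcall ℓ V) =
    cong (λ V′ → shift0 (lam (app (force (var zero)) (inj ℓ (pair V′ _)))))
         (trans (cong (renV wk2) (trV-subV eq V))
                (renV-subV-comm (λ i → sym (renV-renV (λ _ → refl) (σ′ i))) (trV V)))
  trC-subC eq (handle M H@(handler _ _)) =
    cong₂ app (cong₂ reset (trC-subC eq M) (retᵗ-subH eq H)) (opsᵗ-subH eq H)

  trCls-subCls : {σ : Sub eff n m} {σ′ : Sub del n m} → trV ∘ σ ≗ σ′ →
                 (cs : List (Label × Comp eff n)) → trCls (subCls σ cs) ≡ subCls σ′ (trCls cs)
  trCls-subCls eq []             = refl
  trCls-subCls eq ((ℓ , M) ∷ cs) = cong-clause (trC-subC eq M) (trCls-subCls eq cs)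

  retᵗ-subH : {σ : Sub eff n m} {σ′ : Sub del n m} → trV ∘ σ ≗ σ′ →
              (H : Handler n) → retᵗ (subH σ H) ≡ subC (extS σ′) (retᵗ H)
  retᵗ-subH eq (handler N _) =
    cong lam (trans (cong (renC suc) (trC-subC (trV-extS eq) N)) (renC-subC-comm (λ _ → refl) (trC N)))

  opsᵗ-subH : {σ : Sub eff n m} {σ′ : Sub del n m} → trV ∘ σ ≗ σ′ →
              (H : Handler n) → opsᵗ (subH σ H) ≡ subV σ′ (opsᵗ H)
  opsᵗ-subH eq (handler _ ops) = cong (λ cs → thunk (lam (case (var zero) cs))) (trOps-subCls eq ops)

  trOps-subCls : {σ : Sub eff n m} {σ′ : Sub del n m} → trV ∘ σ ≗ σ′ →
                 (os : List (Label × Comp eff (suc (suc n)))) →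
                 trOps (subCls (extS (extS σ)) os) ≡ subCls (extS (extS σ′)) (trOps os)
  trOps-subCls eq []             = refl
  trOps-subCls eq ((ℓ , N) ∷ os) = cong-clause (opClauseᵗ-subC eq N) (trOps-subCls eq os)

  opClauseᵗ-subC : {σ : Sub eff n m} {σ′ : Sub del n m} → trV ∘ σ ≗ σ′ →
                   (N : Comp eff (suc (suc n))) →
                   opClauseᵗ (subC (extS (extS σ)) N) ≡ subC (extS (extS σ′)) (opClauseᵗ N)
  opClauseᵗ-subC {σ′ = σ′} eq N =
    cong (split (var zero))
         (trans (cong (renC (extR (extR wk2))) (trC-subC (trV-extS (trV-extS eq)) N))
                (renC-subC-comm (λ { zero          → refl
                                   ; (suc zero)    → refl
                                   ; (suc (suc j)) → weaken⁴-under₂ (σ′ j) })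
                                (trC N)))

trC-sub1 : (M : Comp eff (suc n)) (V : Val eff n) → trC (subC (sub1 V) M) ≡ subC (sub1 (trV V)) (trC M)
trC-sub1 M V = trC-subC (λ { zero → refl ; (suc _) → refl }) M

trC-sub2 : (M : Comp eff (suc (suc n))) (V W : Val eff n) →
           trC (subC (sub2 V W) M) ≡ subC (sub2 (trV V) (trV W)) (trC M)
trC-sub2 M V W = trC-subC (λ { zero → refl ; (suc zero) → refl ; (suc (suc _)) → refl }) M

trB : BFrame eff n → BFrame del n
trB (letF N) = letF (trC N)
trB (appF V) = appF (trV V)
trB (prjF i) = prjF i

trHC : HCtx eff n → HCtx del n
trHC hole    = hole
trHC (K ▷ B) = trHC K ▷ trB B

trC-plugB : (B : BFrame eff n) (M : Comp eff n) → trC (plugB B M) ≡ plugB (trB B) (trC M)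
trC-plugB (letF N) M = refl
trC-plugB (appF V) M = refl
trC-plugB (prjF i) M = refl

trC-plugH : (K : HCtx eff n) (M : Comp eff n) → trC (plugH K M) ≡ plugH (trHC K) (trC M)
trC-plugH hole    M = refl
trC-plugH (K ▷ B) M = trans (trC-plugH K (plugB B M)) (cong (plugH (trHC K)) (trC-plugB B M))

trHC-renHCtx : (ρ : Ren n m) (K : HCtx eff n) → trHC (renHCtx ρ K) ≡ renHCtx ρ (trHC K)
trHC-renHCtx ρ hole         = refl
trHC-renHCtx ρ (K ▷ letF N) = cong₂ _▷_ (trHC-renHCtx ρ K) (cong letF (trC-renC (extR ρ) N))
trHC-renHCtx ρ (K ▷ appF V) = cong₂ _▷_ (trHC-renHCtx ρ K) (cong appF (trV-renV ρ V))
trHC-renHCtx ρ (K ▷ prjF i) = cong (_▷ prjF i) (trHC-renHCtx ρ K)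

∈-trCls : {ℓ : Label} {M : Comp eff n} {cs : List (Label × Comp eff n)} →
          (ℓ , M) ∈ cs → (ℓ , trC M) ∈ trCls cs
∈-trCls {cs = _ ∷ _} (here refl) = here refl
∈-trCls {cs = _ ∷ _} (there p)   = there (∈-trCls p)

∈-trOps : {ℓ : Label} {N : Comp eff (suc (suc n))} {os : List (Label × Comp eff (suc (suc n)))} →
          (ℓ , N) ∈ os → (ℓ , opClauseᵗ N) ∈ trOps os
∈-trOps {os = _ ∷ _} (here refl) = here refl
∈-trOps {os = _ ∷ _} (there p)   = there (∈-trOps p)

_⇝⁺_ : Comp del n → Comp del n → Set
_⇝⁺_ = TransClosure _⇝_

⇝⁺-map : (f : Comp del n → Comp del n) → (∀ {M N} → M ⇝ N → f M ⇝ f N) →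
         ∀ {M N} → M ⇝⁺ N → f M ⇝⁺ f N
⇝⁺-map f f-mono [ r ]   = [ f-mono r ]
⇝⁺-map f f-mono (r ∷ p) = f-mono r ∷ ⇝⁺-map f f-mono p

infixl 4 _⇝≡_
_⇝≡_ : {M N N′ : Comp del n} → M ⇝ N → N ≡ N′ → M ⇝ N′
s ⇝≡ refl = s

simulate-core : {M N : Comp eff n} → CoreBeta M N → trC M ⇝ trC N
simulate-core (β-split {V₁} {V₂} {M}) = beta (core β-split) ⇝≡ sym (trC-sub2 M V₁ V₂)
simulate-core (β-case {V = V} {M} p)  = beta (core (β-case (∈-trCls p))) ⇝≡ sym (trC-sub1 M V)
simulate-core β-force                 = beta (core β-force)
simulate-core (β-let {V} {N})         = beta (core β-let) ⇝≡ sym (trC-sub1 N V)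
simulate-core (β-app {M} {V})         = beta (core β-app) ⇝≡ sym (trC-sub1 M V)
simulate-core β-prj₁                  = beta (core β-prj₁)
simulate-core β-prj₂                  = beta (core β-prj₂)

simulate-ret : (V : Val eff n) (H : Handler n) → trC (handle (ret V) H) ⇝⁺ trC (subC (sub1 V) (retClause H))
simulate-ret V H@(handler N _) =
  app₁ (beta β-reset) ∷ [ beta (core β-app) ⇝≡ trans returned (sym (trC-sub1 N V)) ]
  where
  returned : subC (sub1 (opsᵗ H)) (subC (extS (sub1 (trV V))) (renC suc (trC N))) ≡ subC (sub1 (trV V)) (trC N)
  returned = subC-subC-renC (λ { zero → subV-sub1-weaken (opsᵗ H) (trV V) ; (suc _) → refl }) (trC N)

resumption : HCtx eff n → Handler n → Val eff n
resumption K H = thunk (lam (handle (plugH (renHCtx suc K) (ret (var zero))) (renH suc H)))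

captured : HCtx del n → Comp del (suc n) → Comp del (suc n)
captured K N = reset (plugH (renHCtx suc K) (ret (var zero))) (renC (extR suc) N)

trV-resumption : (K : HCtx eff n) (H : Handler n) →
                 trV (resumption K H) ≡ thunk (lam (app (captured (trHC K) (retᵗ H)) (renV suc (opsᵗ H))))
trV-resumption K H = cong (thunk ∘ lam) (begin
  trC (handle (plugH (renHCtx suc K) (ret (var zero))) (renH suc H))
    ≡⟨ trC-handle _ (renH suc H) ⟩
  app (reset (trC (plugH (renHCtx suc K) (ret (var zero)))) (retᵗ (renH suc H))) (opsᵗ (renH suc H))
    ≡⟨ cong₂ app (cong₂ reset resumed-context (retᵗ-renH suc H)) (opsᵗ-renH suc H) ⟩
  app (captured (trHC K) (retᵗ H)) (renV suc (opsᵗ H))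
    ∎)
  where
  open ≡-Reasoning
  resumed-context : trC (plugH (renHCtx suc K) (ret (var zero))) ≡ plugH (renHCtx suc (trHC K)) (ret (var zero))
  resumed-context = trans (trC-plugH (renHCtx suc K) (ret (var zero)))
                          (cong (λ K′ → plugH K′ (ret (var zero))) (trHC-renHCtx suc K))

-- S₀ captures the handled context and the handler's λh receives {H^ops}, which is forced and applied
-- to select the clause; inside the resumption, k! y h is reduced to the translated handle of the
-- resumed context; the final split binds p and k.
simulate-op : {K : HCtx eff n} {ℓ : Label} {V : Val eff n} {H : Handler n} {N : Comp eff (suc (suc n))} →
              (ℓ , N) ∈ opClauses H →
              trC (handle (plugH K (opcall ℓ V)) H) ⇝⁺ trC (subC (sub2 V (resumption K H)) N)
simulate-op {n} {K} {ℓ} {V} {H@(handler _ _)} {N} p =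
  subst (λ M → app (reset M (retᵗ H)) (opsᵗ H) ⇝⁺ _) (sym (trC-plugH K (opcall ℓ V)))
    ( app₁ (beta (β-shift {K = trHC K}))
    ∷ beta (core β-app)
    ∷ app₁ (beta (core β-force))
    ∷ beta (core β-app)
    ∷ beta (core (β-case (∈-subCls (∈-trOps p))))
    ∷ split₁ (pair₂ (thunk₁ (lam₁ (app₁ (app₁ (beta (core β-force)))))))
    ∷ split₁ (pair₂ (thunk₁ (lam₁ (app₁ (beta (core β-app))))))
    ∷ [ beta (core β-split) ⇝≡
          trans (cong (subC _) (subC-subC-renC-id (λ { zero          → refl
                                                     ; (suc zero)    → refl
                                                     ; (suc (suc _)) → refl })
                                                  (trC N)))
                (sym (trC-subC (λ { zero → sym resumption-restored
                                  ; (suc zero) → sym argument-restored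
                                  ; (suc (suc _)) → refl })
                               N)) ])
  where
  -- N*, V* and the captured continuation were weakened past the binders (y and the case variable;
  -- h and k) that the reduction instantiates, so they come back unchanged.
  Hᵗ : Val del n
  Hᵗ = opsᵗ H

  κ : Comp del (suc n)
  κ = captured (trHC K) (retᵗ H)

  argument-restored : subV (sub1 Hᵗ) (subV (extS (sub1 (thunk (lam κ)))) (renV wk2 (trV V))) ≡ trV V
  argument-restored = subV-subV-renV-id (λ _ → refl) (trV V)

  continuation-restored :
    subC (sub1 (var zero)) (subC (extS (extS (sub1 Hᵗ))) (renC (extR suc) (renC (extR suc) κ))) ≡ κ
  continuation-restored =
    trans (cong (subC (sub1 (var zero)) ∘ subC (extS (extS (sub1 Hᵗ))))
                (renC-renC (extR-extR (λ _ → refl)) κ))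
          (subC-subC-renC-id (λ { zero → refl ; (suc _) → refl }) κ)

  resumption-restored : thunk (lam (app (subC (sub1 (var zero)) (subC (extS (extS (sub1 Hᵗ)))
                                                                       (renC (extR suc) (renC (extR suc) κ))))
                                        (renV suc Hᵗ)))
                        ≡ trV (resumption K H)
  resumption-restored = trans (cong (λ M → thunk (lam (app M (renV suc Hᵗ)))) continuation-restored)
                              (sym (trV-resumption K H))

simulate-β : {M N : Comp eff n} → EffBeta M N → trC M ⇝⁺ trC N
simulate-β (core r)        = [ simulate-core r ]
simulate-β (β-ret {V} {H}) = simulate-ret V H
simulate-β (β-op {K} p)    = simulate-op {K = K} p

simulate-plugF : (F : Frame eff n) {M N : Comp eff n} →
                 trC M ⇝⁺ trC N → trC (plugF F M) ⇝⁺ trC (plugF F N)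
simulate-plugF (basic (letF N)) = ⇝⁺-map (λ M → letin M (trC N)) letin₁
simulate-plugF (basic (appF V)) = ⇝⁺-map (λ M → app M (trV V)) app₁
simulate-plugF (basic (prjF i)) = ⇝⁺-map (prj i) prj₁
simulate-plugF (handleF H@(handler _ _)) =
  ⇝⁺-map (λ M → app (reset M (retᵗ H)) (opsᵗ H)) (app₁ ∘ reset₁)

simulate-plugE : (K : ECtx eff n) {M N : Comp eff n} →
                 trC M ⇝⁺ trC N → trC (plugE K M) ⇝⁺ trC (plugE K N)
simulate-plugE hole    p = p
simulate-plugE (K ▷ F) p = simulate-plugE K (simulate-plugF F p)

theorem6p7 : ∀ {n} (M N : Comp eff n) → M ⟶ₑ N → TransClosure _⇝_ (trC M) (trC N)
theorem6p7 _ _ (step K r) = simulate-plugE K (simulate-β r)
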